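{- Let $V$ be a quasivariety and $X$ a point of $V$. Then $X$ is computable if and only if $X$ is recursively presented and recursively discriminable.
   Context: $I$ is a computable countable set identified with $\mathbb{N}$. A quasivariety $V$ is given by a recursively enumerable set $S$ of finite sequences $(n_0,\dots,n_k)$ of elements of $I$: $V$ is the set of all $X\subseteq I$ such that for every $(n_0,\dots,n_k)\in S$, if $n_1,\dots,n_k\in X$ then $n_0\in X$. Elements of $V$ are points; $V$ contains $I$ and is closed under arbitrary intersections. A presentation of $X\in V$ is a set $Y\subseteq I$ such that $X$ is the smallest point of $V$ containing $Y$; $X$ is recursively presented if it has a recursively enumerable presentation. A set $Y\subseteq I$ is a discriminator for $X$ if $Y\cap X=\emptyset$ and every point $X'\in V$ with $X\subsetneq X'$ satisfies $X'\cap Y\ne\emptyset$; $X$ is recursively discriminable if it has a recursively enumerable discriminator. -}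

module Defs where

open import Level using (0ℓ)
open import Data.Nat using (ℕ; zero; suc; _+_; _*_; _^_; _<_)
open import Data.Fin using (Fin)
open import Data.Vec using (Vec; []; _∷_; lookup)
open import Data.List using (List; []; _∷_)
open import Data.List.Relation.Unary.All using (All)
open import Data.Product using (Σ; ∃; _×_; _,_)
open import Relation.Nullary using (¬_)
open import Relation.Binary.PropositionalEquality using (_≡_)
open import Function.Bundles using (_⇔_)

data PR : ℕ → Set where
  Zf   : ∀ {n} → PR n
  Sf   : PR 1
  Pf   : ∀ {n} → Fin n → PR n
  Cf   : ∀ {m n} → PR m → Vec (PR n) m → PR n
  Rf   : ∀ {n} → PR n → PR (suc (suc n)) → PR (suc n)  -- primitive recursion (on the first argument)
  Mf   : ∀ {n} → PR (suc n) → PR n                      -- unbounded minimisation (on the first argument)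

mutual
  data _[_]⇓_ : ∀ {n} → PR n → Vec ℕ n → ℕ → Set where
    evZ : ∀ {n} {xs : Vec ℕ n} → Zf [ xs ]⇓ 0
    evS : ∀ {x} → Sf [ x ∷ [] ]⇓ suc x
    evP : ∀ {n} {i : Fin n} {xs : Vec ℕ n} → Pf i [ xs ]⇓ lookup xs i
    evC : ∀ {m n} {f : PR m} {gs : Vec (PR n) m} {xs : Vec ℕ n} {ys : Vec ℕ m} {v} →
          gs [ xs ]⇓* ys → f [ ys ]⇓ v → Cf f gs [ xs ]⇓ v
    evR0 : ∀ {n} {g : PR n} {h : PR (suc (suc n))} {xs : Vec ℕ n} {v} →
           g [ xs ]⇓ v → Rf g h [ 0 ∷ xs ]⇓ v
    evRs : ∀ {n} {g : PR n} {h : PR (suc (suc n))} {xs : Vec ℕ n} {k a v} →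
           Rf g h [ k ∷ xs ]⇓ a → h [ k ∷ a ∷ xs ]⇓ v → Rf g h [ suc k ∷ xs ]⇓ v
    evM : ∀ {n} {f : PR (suc n)} {xs : Vec ℕ n} {y} →
          f [ y ∷ xs ]⇓ 0 →
          (∀ i → i < y → ∃ λ v → f [ i ∷ xs ]⇓ suc v) →
          Mf f [ xs ]⇓ y

  data _[_]⇓*_ : ∀ {m n} → Vec (PR n) m → Vec ℕ n → Vec ℕ m → Set where
    ev[] : ∀ {n} {xs : Vec ℕ n} → [] [ xs ]⇓* []
    ev∷  : ∀ {m n} {g : PR n} {gs : Vec (PR n) m} {xs : Vec ℕ n} {y ys} →
           g [ xs ]⇓ y → gs [ xs ]⇓* ys → (g ∷ gs) [ xs ]⇓* (y ∷ ys)

Subset : Set₁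
Subset = ℕ → Set

Computable : Subset → Set
Computable X = Σ (PR 1) λ e → ∀ n → (X n → e [ n ∷ [] ]⇓ 1) × (¬ X n → e [ n ∷ [] ]⇓ 0)

RE : Subset → Set
RE Y = Σ (PR 1) λ e → ∀ n → Y n ⇔ (∃ λ v → e [ n ∷ [] ]⇓ v)

code : List ℕ → ℕ
code []       = 0
code (x ∷ xs) = 2 ^ x * suc (2 * code xs)

REList : (List ℕ → Set) → Set
REList S = RE (λ n → Σ (List ℕ) λ l → code l ≡ n × S l)

-- A quasivariety is given by an r.e. set S of sequences (n₀, n₁, …, nₖ),
-- each read as the rule  n₁,…,nₖ ∈ X ⇒ n₀ ∈ X.
record Quasivariety : Set₁ where
  field
    S    : List ℕ → Set
    S-re : REList S

Point : Quasivariety → Subset → Set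
Point V X = ∀ n₀ ns → Quasivariety.S V (n₀ ∷ ns) → All X ns → X n₀

_⊆_ : Subset → Subset → Set
A ⊆ B = ∀ n → A n → B n

IsPresentation : Quasivariety → Subset → Subset → Set₁
IsPresentation V X Y = Point V X × Y ⊆ X × (∀ X' → Point V X' → Y ⊆ X' → X ⊆ X')

RecursivelyPresented : Quasivariety → Subset → Set₁
RecursivelyPresented V X = Σ Subset λ Y → RE Y × IsPresentation V X Y

_⊊_ : Subset → Subset → Set
X ⊊ X' = X ⊆ X' × (∃ λ n → X' n × ¬ X n)

IsDiscriminator : Quasivariety → Subset → Subset → Set₁
IsDiscriminator V X Y =
  (∀ n → Y n → ¬ X n) ×
  (∀ X' → Point V X' → X ⊊ X' → ∃ λ n → X' n × Y n)

RecursivelyDiscriminable : Quasivariety → Subset → Set₁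
RecursivelyDiscriminable V X = Σ Subset λ Y → RE Y × IsDiscriminator V X Y

module Submission where

-- A computable point is presented by itself and discriminated by its complement.
-- Conversely, let Y present X and Z discriminate X. Then X is the set of elements
-- derivable from Y by the rules of V, and n ∉ X exactly when some element derivable
-- from Y ∪ {n} lies in Z: if n ∉ X, the point generated by Y ∪ {n} strictly contains X,
-- so it meets Z; if n ∈ X, that point is X, which is disjoint from Z. Both conditions
-- are semi-decidable uniformly in n, through a clocked evaluator for partial recursive
-- codes, so searching for a witness of either one decides X; excluded middle
-- guarantees that the search ends.

open import Defs
open import Level using (0ℓ)
open import Axiom.ExcludedMiddle using (ExcludedMiddle)
open import Data.Bool using (Bool; true; false; _∧_; _∨_; not)
open import Data.Bool.Properties using (T-≡)
open import Data.Empty using (⊥-elim)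
open import Data.Fin using (Fin; zero; suc)
open import Data.List using (List; []; _∷_; length; drop)
open import Data.List.Properties using (drop-all; drop-drop)
open import Data.List.Relation.Unary.All using (All; []; _∷_) renaming (map to All-map)
open import Data.List.Relation.Unary.All.Properties using (drop⁺)
open import Data.Nat hiding (parity)
open import Data.Nat.Properties
open import Data.Nat.Tactic.RingSolver using (solve-∀)
open import Data.Product using (Σ; ∃; _×_; _,_; proj₁; proj₂; map₂)
open import Data.Sum using (_⊎_; inj₁; inj₂)
open import Data.Vec as Vec using (Vec; []; _∷_; lookup; tabulate; tail; map)
open import Data.Vec.Properties using (tabulate∘lookup; map-∘; map-id)
open import Function using (_∘_)
open import Function.Bundles using (_⇔_; mk⇔; Equivalence)
open import Relation.Binary.PropositionalEquality
open import Relation.Nullary using (¬_; yes; no; does)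

Comp : (n : ℕ) → (Vec ℕ n → ℕ) → Set
Comp n f = Σ (PR n) λ e → ∀ xs → e [ xs ]⇓ f xs

Comp* : (m n : ℕ) → (Vec ℕ n → Vec ℕ m) → Set
Comp* m n F = Σ (Vec (PR n) m) λ es → ∀ xs → es [ xs ]⇓* F xs

Comp₁ : (ℕ → ℕ) → Set
Comp₁ f = Comp 1 (λ xs → f (lookup xs zero))

Comp₂ : (ℕ → ℕ → ℕ) → Set
Comp₂ f = Comp 2 (λ xs → f (lookup xs zero) (lookup xs (suc zero)))

Comp-ext : ∀ {n} {f g : Vec ℕ n → ℕ} → Comp n f → (∀ xs → f xs ≡ g xs) → Comp n g
Comp-ext (e , e⇓) f≡g = e , λ xs → subst (e [ xs ]⇓_) (f≡g xs) (e⇓ xs)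

Comp*-ext : ∀ {m n} {F G : Vec ℕ n → Vec ℕ m} → Comp* m n F → (∀ xs → F xs ≡ G xs) → Comp* m n G
Comp*-ext (es , es⇓) F≡G = es , λ xs → subst (es [ xs ]⇓*_) (F≡G xs) (es⇓ xs)

cZero : ∀ {n} → Comp n (λ _ → 0)
cZero = Zf , λ _ → evZ

cSuc : Comp₁ suc
cSuc = Sf , λ { (x ∷ []) → evS }

cProj : ∀ {n} (i : Fin n) → Comp n (λ xs → lookup xs i)
cProj i = Pf i , λ _ → evP

c[] : ∀ {n} → Comp* 0 n (λ _ → [])
c[] = [] , λ _ → ev[]

c∷ : ∀ {m n} {g : Vec ℕ n → ℕ} {F : Vec ℕ n → Vec ℕ m} →
     Comp n g → Comp* m n F → Comp* (suc m) n (λ xs → g xs ∷ F xs)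
c∷ (e , e⇓) (es , es⇓) = e ∷ es , λ xs → ev∷ (e⇓ xs) (es⇓ xs)

cComp : ∀ {m n} {f : Vec ℕ m → ℕ} {F : Vec ℕ n → Vec ℕ m} →
        Comp m f → Comp* m n F → Comp n (λ xs → f (F xs))
cComp (e , e⇓) (es , es⇓) = Cf e es , λ xs → evC (es⇓ xs) (e⇓ _)

cPrimRec : ∀ {n} {g : Vec ℕ n → ℕ} {h : Vec ℕ (suc (suc n)) → ℕ} {f : Vec ℕ (suc n) → ℕ} →
           Comp n g → Comp (suc (suc n)) h →
           (∀ xs → f (0 ∷ xs) ≡ g xs) → (∀ k xs → f (suc k ∷ xs) ≡ h (k ∷ f (k ∷ xs) ∷ xs)) →
           Comp (suc n) f
cPrimRec {f = f} (eg , eg⇓) (eh , eh⇓) f-zero f-suc = Rf eg eh , go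
  where
  go : ∀ xs → Rf eg eh [ xs ]⇓ f xs
  go (zero ∷ xs)  = subst (Rf eg eh [ 0 ∷ xs ]⇓_) (sym (f-zero xs)) (evR0 (eg⇓ xs))
  go (suc k ∷ xs) = subst (Rf eg eh [ suc k ∷ xs ]⇓_) (sym (f-suc k xs)) (evRs (go (k ∷ xs)) (eh⇓ _))

cSelect : ∀ {m n} (σ : Fin m → Fin n) → Comp* m n (λ xs → tabulate (λ i → lookup xs (σ i)))
cSelect {zero}  σ = c[]
cSelect {suc m} σ = c∷ (cProj (σ zero)) (cSelect (σ ∘ suc))

cConst : ∀ {n} k → Comp n (λ _ → k)
cConst zero    = cZero
cConst (suc k) = cComp cSuc (c∷ (cConst k) c[])

app₁ : ∀ {n} (f : ℕ → ℕ) {g : Vec ℕ n → ℕ} → Comp₁ f → Comp n g → Comp n (λ xs → f (g xs))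
app₁ f cf cg = cComp cf (c∷ cg c[])

app₂ : ∀ {n} (f : ℕ → ℕ → ℕ) {g h : Vec ℕ n → ℕ} →
       Comp₂ f → Comp n g → Comp n h → Comp n (λ xs → f (g xs) (h xs))
app₂ f cf cg ch = cComp cf (c∷ cg (c∷ ch c[]))

arg₀ : ∀ {n} → Comp (suc n) (λ xs → lookup xs zero)
arg₀ = cProj zero

arg₁ : ∀ {n} → Comp (suc (suc n)) (λ xs → lookup xs (suc zero))
arg₁ = cProj (suc zero)

arg₂ : ∀ {n} → Comp (suc (suc (suc n))) (λ xs → lookup xs (suc (suc zero)))
arg₂ = cProj (suc (suc zero))

arg₃ : ∀ {n} → Comp (suc (suc (suc (suc n)))) (λ xs → lookup xs (suc (suc (suc zero))))
arg₃ = cProj (suc (suc (suc zero)))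

cDrop₁ : ∀ {n} → Comp* n (suc n) tail
cDrop₁ {n} = Comp*-ext (cSelect {n} suc) λ { (_ ∷ xs) → tabulate∘lookup xs }

cDrop₂ : ∀ {n} → Comp* n (suc (suc n)) (tail ∘ tail)
cDrop₂ {n} = Comp*-ext (cSelect {n} (λ i → suc (suc i))) λ { (_ ∷ _ ∷ xs) → tabulate∘lookup xs }

cDrop₃ : ∀ {n} → Comp* n (suc (suc (suc n))) (tail ∘ tail ∘ tail)
cDrop₃ {n} = Comp*-ext (cSelect {n} (λ i → suc (suc (suc i)))) λ { (_ ∷ _ ∷ _ ∷ xs) → tabulate∘lookup xs }

cSwap : ∀ (f : ℕ → ℕ → ℕ) → Comp 2 (λ xs → f (lookup xs (suc zero)) (lookup xs zero)) → Comp₂ f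
cSwap f cf = cComp cf (c∷ arg₁ (c∷ arg₀ c[]))

cSkip₁ : ∀ {n} {f : Vec ℕ (suc n) → ℕ} → Comp (suc n) f →
         Comp (suc (suc n)) (λ xs → f (lookup xs zero ∷ tail (tail xs)))
cSkip₁ cf = cComp cf (c∷ arg₀ cDrop₂)

c+ : Comp₂ _+_
c+ = cPrimRec arg₀ (app₁ suc cSuc arg₁) (λ _ → refl) (λ _ _ → refl)

c* : Comp₂ _*_
c* = cPrimRec cZero (app₂ _+_ c+ arg₂ arg₁) (λ _ → refl) (λ _ _ → refl)

cPred : Comp₁ pred
cPred = cPrimRec cZero arg₀ (λ _ → refl) (λ _ _ → refl)

c∸ : Comp₂ _∸_
c∸ = cSwap _∸_ (cPrimRec arg₀ (app₁ pred cPred arg₁) (λ _ → refl) (λ k xs → sym (pred[m∸n]≡m∸[1+n] (lookup xs zero) k)))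

isZero : ℕ → ℕ
isZero zero    = 1
isZero (suc _) = 0

sign : ℕ → ℕ
sign zero    = 0
sign (suc _) = 1

cIsZero : Comp₁ isZero
cIsZero = cPrimRec (cConst 1) cZero (λ _ → refl) (λ _ _ → refl)

cSign : Comp₁ sign
cSign = cPrimRec cZero (cConst 1) (λ _ → refl) (λ _ _ → refl)

fromBool : Bool → ℕ
fromBool true  = 1
fromBool false = 0

CompB : (n : ℕ) → (Vec ℕ n → Bool) → Set
CompB n p = Comp n (λ xs → fromBool (p xs))

fromBool-∧ : ∀ a b → fromBool (a ∧ b) ≡ fromBool a * fromBool b
fromBool-∧ true  b = sym (+-identityʳ (fromBool b))
fromBool-∧ false b = refl

fromBool-∨ : ∀ a b → fromBool (a ∨ b) ≡ sign (fromBool a + fromBool b)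
fromBool-∨ true  b     = refl
fromBool-∨ false true  = refl
fromBool-∨ false false = refl

fromBool-not : ∀ a → fromBool (not a) ≡ isZero (fromBool a)
fromBool-not true  = refl
fromBool-not false = refl

c∧ : ∀ {n} {p q : Vec ℕ n → Bool} → CompB n p → CompB n q → CompB n (λ xs → p xs ∧ q xs)
c∧ {p = p} {q} cp cq = Comp-ext (app₂ _*_ c* cp cq) λ xs → sym (fromBool-∧ (p xs) (q xs))

c∨ : ∀ {n} {p q : Vec ℕ n → Bool} → CompB n p → CompB n q → CompB n (λ xs → p xs ∨ q xs)
c∨ {p = p} {q} cp cq = Comp-ext (app₁ sign cSign (app₂ _+_ c+ cp cq)) λ xs → sym (fromBool-∨ (p xs) (q xs))

cNot : ∀ {n} {p : Vec ℕ n → Bool} → CompB n p → CompB n (λ xs → not (p xs))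
cNot {p = p} cp = Comp-ext (app₁ isZero cIsZero cp) λ xs → sym (fromBool-not (p xs))

c≡ᵇ : ∀ {n} {f g : Vec ℕ n → ℕ} → Comp n f → Comp n g → CompB n (λ xs → f xs ≡ᵇ g xs)
c≡ᵇ {f = f} {g} cf cg =
  Comp-ext (app₁ isZero cIsZero (app₂ _+_ c+ (app₂ _∸_ c∸ cf cg) (app₂ _∸_ c∸ cg cf))) λ xs → eq (f xs) (g xs)
  where
  eq : ∀ a b → isZero ((a ∸ b) + (b ∸ a)) ≡ fromBool (a ≡ᵇ b)
  eq zero    zero    = refl
  eq zero    (suc b) = refl
  eq (suc a) zero    = refl
  eq (suc a) (suc b) = eq a b

c<ᵇ : ∀ {n} {f g : Vec ℕ n → ℕ} → Comp n f → Comp n g → CompB n (λ xs → f xs <ᵇ g xs)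
c<ᵇ {f = f} {g} cf cg = Comp-ext (app₁ sign cSign (app₂ _∸_ c∸ cg cf)) λ xs → lt (f xs) (g xs)
  where
  lt : ∀ a b → sign (b ∸ a) ≡ fromBool (a <ᵇ b)
  lt zero    zero    = refl
  lt zero    (suc b) = refl
  lt (suc a) zero    = refl
  lt (suc a) (suc b) = lt a b

all< : ℕ → (ℕ → Bool) → Bool
all< zero    p = true
all< (suc b) p = all< b p ∧ p b

any< : ℕ → (ℕ → Bool) → Bool
any< zero    p = false
any< (suc b) p = any< b p ∨ p b

cAll< : ∀ {n} {p : Vec ℕ (suc n) → Bool} → CompB (suc n) p →
        CompB (suc n) (λ xs → all< (lookup xs zero) (λ i → p (i ∷ tail xs)))
cAll< {p = p} cp = cPrimRec (cConst 1) (app₂ _*_ c* arg₁ (cSkip₁ cp)) (λ _ → refl)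
  λ k xs → fromBool-∧ (all< k (λ i → p (i ∷ xs))) (p (k ∷ xs))

cAny< : ∀ {n} {p : Vec ℕ (suc n) → Bool} → CompB (suc n) p →
        CompB (suc n) (λ xs → any< (lookup xs zero) (λ i → p (i ∷ tail xs)))
cAny< {p = p} cp = cPrimRec cZero (app₁ sign cSign (app₂ _+_ c+ arg₁ (cSkip₁ cp))) (λ _ → refl)
  λ k xs → fromBool-∨ (any< k (λ i → p (i ∷ xs))) (p (k ∷ xs))

∧-true⁻ : ∀ {a b} → a ∧ b ≡ true → a ≡ true × b ≡ true
∧-true⁻ {true} {true} _ = refl , refl

∧-true⁺ : ∀ {a b} → a ≡ true → b ≡ true → a ∧ b ≡ true
∧-true⁺ refl refl = refl

∨-true⁻ : ∀ {a b} → a ∨ b ≡ true → a ≡ true ⊎ b ≡ true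
∨-true⁻ {true}          _ = inj₁ refl
∨-true⁻ {false} {true}  _ = inj₂ refl

∨-trueˡ : ∀ {a b} → a ≡ true → a ∨ b ≡ true
∨-trueˡ refl = refl

∨-trueʳ : ∀ {a b} → b ≡ true → a ∨ b ≡ true
∨-trueʳ {true}  refl = refl
∨-trueʳ {false} refl = refl

≡ᵇ-true⁻ : ∀ {x y} → (x ≡ᵇ y) ≡ true → x ≡ y
≡ᵇ-true⁻ {x} {y} h = ≡ᵇ⇒≡ x y (Equivalence.from T-≡ h)

≡ᵇ-true⁺ : ∀ {x y} → x ≡ y → (x ≡ᵇ y) ≡ true
≡ᵇ-true⁺ {x} {y} x≡y = Equivalence.to T-≡ (≡⇒≡ᵇ x y x≡y)

<ᵇ-true⁻ : ∀ {x y} → (x <ᵇ y) ≡ true → x < y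
<ᵇ-true⁻ {x} {y} h = <ᵇ⇒< x y (Equivalence.from T-≡ h)

<ᵇ-true⁺ : ∀ {x y} → x < y → (x <ᵇ y) ≡ true
<ᵇ-true⁺ x<y = Equivalence.to T-≡ (<⇒<ᵇ x<y)

fromBool≡1⁻ : ∀ {b} → fromBool b ≡ 1 → b ≡ true
fromBool≡1⁻ {true} _ = refl

all<-true⁻ : ∀ b p → all< b p ≡ true → ∀ i → i < b → p i ≡ true
all<-true⁻ (suc b) p h i i<1+b with ∧-true⁻ {all< b p} h | m<1+n⇒m<n∨m≡n i<1+b
... | all , _  | inj₁ i<b  = all<-true⁻ b p all i i<b
... | _   , pb | inj₂ refl = pb

all<-true⁺ : ∀ b p → (∀ i → i < b → p i ≡ true) → all< b p ≡ true
all<-true⁺ zero    p h = refl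
all<-true⁺ (suc b) p h = ∧-true⁺ (all<-true⁺ b p (λ i i<b → h i (m<n⇒m<1+n i<b))) (h b ≤-refl)

all<-false⁺ : ∀ b p i → i < b → p i ≡ false → all< b p ≡ false
all<-false⁺ (suc b) p i i<1+b pi with m<1+n⇒m<n∨m≡n i<1+b
... | inj₁ i<b rewrite all<-false⁺ b p i i<b pi = refl
... | inj₂ refl rewrite pi with all< b p
...   | true  = refl
...   | false = refl

any<-true⁻ : ∀ b p → any< b p ≡ true → ∃ λ i → i < b × p i ≡ true
any<-true⁻ (suc b) p h with ∨-true⁻ {any< b p} h
... | inj₁ any = let (i , i<b , pi) = any<-true⁻ b p any in i , m<n⇒m<1+n i<b , pi
... | inj₂ pb  = b , ≤-refl , pb

any<-true⁺ : ∀ b p i → i < b → p i ≡ true → any< b p ≡ true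
any<-true⁺ (suc b) p i i<1+b pi with m<1+n⇒m<n∨m≡n i<1+b
... | inj₁ i<b  = ∨-trueˡ (any<-true⁺ b p i i<b pi)
... | inj₂ refl = ∨-trueʳ {any< b p} pi

any<-false⁻ : ∀ b p → any< b p ≡ false → ∀ i → i < b → p i ≡ false
any<-false⁻ (suc b) p h i i<1+b with any< b p in any | m<1+n⇒m<n∨m≡n i<1+b
... | false | inj₁ i<b  = any<-false⁻ b p any i i<b
... | false | inj₂ refl = h

least-true : ∀ p t₀ → p t₀ ≡ true → ∃ λ t → p t ≡ true × (∀ i → i < t → p i ≡ false)
least-true p t₀ pt₀ = least (suc t₀) (any<-true⁺ (suc t₀) p t₀ ≤-refl pt₀)
  where
  least : ∀ b → any< b p ≡ true → ∃ λ t → p t ≡ true × (∀ i → i < t → p i ≡ false)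
  least (suc b) h with any< b p in any
  ... | true  = least b any
  ... | false = b , h , any<-false⁻ b p any

-- A clocked evaluator

ReturnsNonzero : ℕ → Set
ReturnsNonzero r = ∃ λ w → r ≡ suc (suc w)

-- The state of a search is 0 while every candidate tried returned a nonzero value,
-- 1 once a candidate failed to halt, and suc (suc y) once y returned 0.
searchStep : ℕ → ℕ → ℕ → ℕ
searchStep (suc s) y r             = suc s
searchStep zero    y zero          = 1
searchStep zero    y (suc zero)    = suc (suc y)
searchStep zero    y (suc (suc r)) = zero

search : (ℕ → ℕ) → ℕ → ℕ
search r zero    = zero
search r (suc b) = searchStep (search r b) b (r b)

allHalted : ∀ {m} → Vec ℕ m → ℕ
allHalted []       = 1
allHalted (r ∷ rs) = sign r * allHalted rs

-- clocked e (t ∷ xs) is suc v if e halts on xs with value v when every unbounded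
-- search performed during the evaluation is cut off at t, and 0 otherwise.
mutual
  clocked : ∀ {n} → PR n → Vec ℕ (suc n) → ℕ
  clocked Zf         _            = 1
  clocked Sf         (t ∷ x ∷ []) = suc (suc x)
  clocked (Pf i)     (t ∷ xs)     = suc (lookup xs i)
  clocked (Cf f gs)  (t ∷ xs)     = allHalted (clocked* gs (t ∷ xs)) * clocked f (t ∷ map pred (clocked* gs (t ∷ xs)))
  clocked (Rf g h)   (t ∷ k ∷ xs) = clockedRec g h t xs k
  clocked (Mf f)     (t ∷ xs)     = pred (search (λ y → clocked f (t ∷ y ∷ xs)) t)

  clocked* : ∀ {m n} → Vec (PR n) m → Vec ℕ (suc n) → Vec ℕ m
  clocked* []       _   = []
  clocked* (g ∷ gs) txs = clocked g txs ∷ clocked* gs txs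

  clockedRec : ∀ {n} → PR n → PR (suc (suc n)) → ℕ → Vec ℕ n → ℕ → ℕ
  clockedRec g h t xs zero    = clocked g (t ∷ xs)
  clockedRec g h t xs (suc k) = sign (clockedRec g h t xs k) * clocked h (t ∷ k ∷ pred (clockedRec g h t xs k) ∷ xs)

cSearchStep : Comp 3 (λ v → searchStep (lookup v zero) (lookup v (suc zero)) (lookup v (suc (suc zero))))
cSearchStep =
  Comp-ext (app₂ _+_ c+ arg₀ (app₂ _*_ c* (app₁ isZero cIsZero arg₀)
             (app₂ _+_ c+ (app₁ isZero cIsZero arg₂)
               (app₂ _*_ c* (app₂ _*_ c* (app₁ isZero cIsZero (app₁ pred cPred arg₂)) (app₁ sign cSign arg₂))
                            (app₂ _+_ c+ arg₁ (cConst 2))))))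
           λ { (s ∷ y ∷ r ∷ []) → formula s y r }
  where
  formula : ∀ s y r → s + isZero s * (isZero r + isZero (pred r) * sign r * (y + 2)) ≡ searchStep s y r
  formula (suc s) y r             = cong suc (+-identityʳ s)
  formula zero    y zero          = refl
  formula zero    y (suc zero)    = arith y
    where
    arith : ∀ y → 0 + 1 * (0 + 1 * 1 * (y + 2)) ≡ 2 + y
    arith = solve-∀
  formula zero    y (suc (suc r)) = refl

mutual
  cClocked : ∀ {n} (e : PR n) → Comp (suc n) (clocked e)
  cClocked Zf        = cConst 1
  cClocked Sf        = Comp-ext (app₁ suc cSuc (app₁ suc cSuc arg₁)) λ { (t ∷ x ∷ []) → refl }
  cClocked (Pf i)    = Comp-ext (app₁ suc cSuc (cProj (suc i))) λ { (t ∷ xs) → refl }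
  cClocked (Cf f gs) = Comp-ext (app₂ _*_ c* (cAllHalted gs) (cComp (cClocked f) (c∷ arg₀ (cPred* gs))))
                                λ { (t ∷ xs) → refl }
  cClocked (Rf g h)  = Comp-ext (cComp (cClockedRec g h) (c∷ arg₁ (c∷ arg₀ cDrop₂))) λ { (t ∷ k ∷ xs) → refl }
  cClocked (Mf f)    = Comp-ext (app₁ pred cPred (cComp (cSearch f) (c∷ arg₀ (c∷ arg₀ cDrop₁))))
                                λ { (t ∷ xs) → refl }

  cClockedRec : ∀ {n} (g : PR n) (h : PR (suc (suc n))) →
                Comp (suc (suc n)) (λ v → clockedRec g h (lookup v (suc zero)) (tail (tail v)) (lookup v zero))
  cClockedRec g h =
    cPrimRec (cClocked g)
             (app₂ _*_ c* (app₁ sign cSign arg₁)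
                         (cComp (cClocked h) (c∷ arg₂ (c∷ arg₀ (c∷ (app₁ pred cPred arg₁) cDrop₃)))))
             (λ { (t ∷ xs) → refl }) (λ { _ (t ∷ xs) → refl })

  cSearch : ∀ {n} (f : PR (suc n)) →
            Comp (suc (suc n)) (λ v → search (λ y → clocked f (lookup v (suc zero) ∷ y ∷ tail (tail v))) (lookup v zero))
  cSearch f =
    cPrimRec cZero (cComp cSearchStep (c∷ arg₁ (c∷ arg₀ (c∷ (cComp (cClocked f) (c∷ arg₂ (c∷ arg₀ cDrop₃))) c[]))))
             (λ _ → refl) (λ { _ (t ∷ xs) → refl })

  cAllHalted : ∀ {m n} (gs : Vec (PR n) m) → Comp (suc n) (λ v → allHalted (clocked* gs v))
  cAllHalted []       = cConst 1
  cAllHalted (g ∷ gs) = app₂ _*_ c* (app₁ sign cSign (cClocked g)) (cAllHalted gs)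

  cPred* : ∀ {m n} (gs : Vec (PR n) m) → Comp* m (suc n) (λ v → map pred (clocked* gs v))
  cPred* []       = c[]
  cPred* (g ∷ gs) = c∷ (app₁ pred cPred (cClocked g)) (cPred* gs)

-- r y ≡ 1 encodes a halt with value 0.
FirstZero : (ℕ → ℕ) → ℕ → Set
FirstZero r y = r y ≡ 1 × (∀ i → i < y → ReturnsNonzero (r i))

search-pending⁻ : ∀ r b → search r b ≡ 0 → ∀ i → i < b → ReturnsNonzero (r i)
search-pending⁻ r (suc b) p i i<1+b with search r b in eq | r b in eqr
search-pending⁻ r (suc b) () i i<1+b | suc s | _
search-pending⁻ r (suc b) () i i<1+b | zero  | zero
search-pending⁻ r (suc b) () i i<1+b | zero  | suc zero
search-pending⁻ r (suc b) p  i i<1+b | zero  | suc (suc w) with m<1+n⇒m<n∨m≡n i<1+b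
... | inj₁ i<b  = search-pending⁻ r b eq i i<b
... | inj₂ refl = w , eqr

search-pending⁺ : ∀ r b → (∀ i → i < b → ReturnsNonzero (r i)) → search r b ≡ 0
search-pending⁺ r zero    h = refl
search-pending⁺ r (suc b) h with h b ≤-refl
... | w , rb rewrite search-pending⁺ r b (λ i i<b → h i (m<n⇒m<1+n i<b)) | rb = refl

search-found⁻ : ∀ r b y → search r b ≡ suc (suc y) → y < b × FirstZero r y
search-found⁻ r (suc b) y p with search r b in eq | r b in eqr
... | suc s | _ = let (y<b , first) = search-found⁻ r b y (trans eq p) in m<n⇒m<1+n y<b , first
search-found⁻ r (suc b) y () | zero | zero
search-found⁻ r (suc b) y refl | zero | suc zero = ≤-refl , eqr , search-pending⁻ r b eq
search-found⁻ r (suc b) y () | zero | suc (suc w)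

search-found⁺ : ∀ r b y → y < b → FirstZero r y → search r b ≡ suc (suc y)
search-found⁺ r (suc b) y y<1+b first@(ry , below) with m<1+n⇒m<n∨m≡n y<1+b
... | inj₁ y<b  rewrite search-found⁺ r b y y<b first = refl
... | inj₂ refl rewrite search-pending⁺ r y below | ry = refl

allHalted-*-suc⁻ : ∀ {m} (rs : Vec ℕ m) y {v} → allHalted rs * y ≡ suc v →
                   (∃ λ ws → rs ≡ map suc ws) × y ≡ suc v
allHalted-*-suc⁻ []           y p = ([] , refl) , trans (sym (+-identityʳ y)) p
allHalted-*-suc⁻ (zero ∷ rs)  y ()
allHalted-*-suc⁻ (suc r ∷ rs) y p
  with allHalted-*-suc⁻ rs y (trans (cong (_* y) (sym (+-identityʳ (allHalted rs)))) p)
... | (ws , refl) , y≡ = (r ∷ ws , refl) , y≡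

allHalted-suc : ∀ {m} (ws : Vec ℕ m) → allHalted (map suc ws) ≡ 1
allHalted-suc []       = refl
allHalted-suc (w ∷ ws) = trans (+-identityʳ _) (allHalted-suc ws)

map-pred-suc : ∀ {m} (ws : Vec ℕ m) → map pred (map suc ws) ≡ ws
map-pred-suc ws = trans (sym (map-∘ pred suc ws)) (map-id ws)

sign-*-suc⁻ : ∀ a y {v} → sign a * y ≡ suc v → (∃ λ a′ → a ≡ suc a′) × y ≡ suc v
sign-*-suc⁻ (suc a) y p = (a , refl) , trans (sym (+-identityʳ y)) p

module _ {m n} (f : PR m) (gs : Vec (PR n) m) {t : ℕ} {xs : Vec ℕ n} {v : ℕ} where

  clocked-Cf⁻ : clocked (Cf f gs) (t ∷ xs) ≡ suc v →
                ∃ λ ws → clocked* gs (t ∷ xs) ≡ map suc ws × clocked f (t ∷ ws) ≡ suc v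
  clocked-Cf⁻ p with allHalted-*-suc⁻ (clocked* gs (t ∷ xs)) _ p
  ... | (ws , gs⇓) , f⇓ =
    ws , gs⇓ , trans (cong (λ zs → clocked f (t ∷ zs)) (sym (trans (cong (map pred) gs⇓) (map-pred-suc ws)))) f⇓

  clocked-Cf⁺ : ∀ {ws} → clocked* gs (t ∷ xs) ≡ map suc ws → clocked f (t ∷ ws) ≡ suc v →
                clocked (Cf f gs) (t ∷ xs) ≡ suc v
  clocked-Cf⁺ {ws} gs⇓ f⇓ rewrite gs⇓ | allHalted-suc ws | map-pred-suc ws = trans (+-identityʳ _) f⇓

module _ {n} (g : PR n) (h : PR (suc (suc n))) {t : ℕ} {xs : Vec ℕ n} {k v : ℕ} where

  clockedRec-suc⁻ : clockedRec g h t xs (suc k) ≡ suc v →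
                    ∃ λ a → clockedRec g h t xs k ≡ suc a × clocked h (t ∷ k ∷ a ∷ xs) ≡ suc v
  clockedRec-suc⁻ p with sign-*-suc⁻ (clockedRec g h t xs k) _ p
  ... | (a , rec⇓) , h⇓ = a , rec⇓ , subst (λ r → clocked h (t ∷ k ∷ pred r ∷ xs) ≡ suc v) rec⇓ h⇓

  clockedRec-suc⁺ : ∀ {a} → clockedRec g h t xs k ≡ suc a → clocked h (t ∷ k ∷ a ∷ xs) ≡ suc v →
                    clockedRec g h t xs (suc k) ≡ suc v
  clockedRec-suc⁺ rec⇓ h⇓ rewrite rec⇓ = trans (+-identityʳ _) h⇓

module _ {n} (f : PR (suc n)) {t : ℕ} {xs : Vec ℕ n} {y : ℕ} where

  clocked-Mf⁻ : clocked (Mf f) (t ∷ xs) ≡ suc y → y < t × FirstZero (λ i → clocked f (t ∷ i ∷ xs)) y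
  clocked-Mf⁻ p with search (λ i → clocked f (t ∷ i ∷ xs)) t in eq
  ... | zero  = ⊥-elim (0≢1+n p)
  ... | suc s = search-found⁻ _ t y (trans eq (cong suc p))

  clocked-Mf⁺ : y < t → FirstZero (λ i → clocked f (t ∷ i ∷ xs)) y → clocked (Mf f) (t ∷ xs) ≡ suc y
  clocked-Mf⁺ y<t first = cong pred (search-found⁺ _ t y y<t first)

mutual
  clocked-mono : ∀ {n} (e : PR n) {t t′ xs v} → t ≤ t′ → clocked e (t ∷ xs) ≡ suc v → clocked e (t′ ∷ xs) ≡ suc v
  clocked-mono Zf                   t≤t′ p = p
  clocked-mono Sf {xs = x ∷ []}     t≤t′ p = p
  clocked-mono (Pf i)               t≤t′ p = p
  clocked-mono (Cf f gs)            t≤t′ p =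
    let (ws , gs⇓ , f⇓) = clocked-Cf⁻ f gs p
    in clocked-Cf⁺ f gs (clocked*-mono gs t≤t′ gs⇓) (clocked-mono f t≤t′ f⇓)
  clocked-mono (Rf g h) {xs = k ∷ xs} t≤t′ p = clockedRec-mono g h t≤t′ k p
  clocked-mono (Mf f)               t≤t′ p =
    let (y<t , f⇓0 , below) = clocked-Mf⁻ f p
    in clocked-Mf⁺ f (<-≤-trans y<t t≤t′) (clocked-mono f t≤t′ f⇓0 , λ i i<y → map₂ (clocked-mono f t≤t′) (below i i<y))

  clocked*-mono : ∀ {m n} (gs : Vec (PR n) m) {t t′ xs ws} → t ≤ t′ →
                  clocked* gs (t ∷ xs) ≡ map suc ws → clocked* gs (t′ ∷ xs) ≡ map suc ws
  clocked*-mono []       {ws = []}     t≤t′ p = refl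
  clocked*-mono (g ∷ gs) {ws = w ∷ ws} t≤t′ p =
    cong₂ _∷_ (clocked-mono g t≤t′ (cong Vec.head p)) (clocked*-mono gs t≤t′ (cong tail p))

  clockedRec-mono : ∀ {n} (g : PR n) (h : PR (suc (suc n))) {t t′ xs v} → t ≤ t′ →
                    ∀ k → clockedRec g h t xs k ≡ suc v → clockedRec g h t′ xs k ≡ suc v
  clockedRec-mono g h t≤t′ zero    p = clocked-mono g t≤t′ p
  clockedRec-mono g h {xs = xs} t≤t′ (suc k) p =
    let (a , rec⇓ , h⇓) = clockedRec-suc⁻ g h {xs = xs} {k} p
    in clockedRec-suc⁺ g h (clockedRec-mono g h t≤t′ k rec⇓) (clocked-mono h t≤t′ h⇓)

mutual
  clocked-sound : ∀ {n} (e : PR n) {t xs v} → clocked e (t ∷ xs) ≡ suc v → e [ xs ]⇓ v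
  clocked-sound Zf                refl = evZ
  clocked-sound Sf {xs = x ∷ []}  refl = evS
  clocked-sound (Pf i)            refl = evP
  clocked-sound (Cf f gs)         p    =
    let (ws , gs⇓ , f⇓) = clocked-Cf⁻ f gs p in evC (clocked*-sound gs gs⇓) (clocked-sound f f⇓)
  clocked-sound (Rf g h) {xs = k ∷ xs} p = clockedRec-sound g h k p
  clocked-sound (Mf f) {t}        p    =
    let (_ , f⇓0 , below) = clocked-Mf⁻ f {t} p
    in evM (clocked-sound f f⇓0) λ i i<y → map₂ (clocked-sound f) (below i i<y)

  clocked*-sound : ∀ {m n} (gs : Vec (PR n) m) {t xs ws} → clocked* gs (t ∷ xs) ≡ map suc ws → gs [ xs ]⇓* ws
  clocked*-sound []       {ws = []}     p = ev[]
  clocked*-sound (g ∷ gs) {ws = w ∷ ws} p = ev∷ (clocked-sound g (cong Vec.head p)) (clocked*-sound gs (cong tail p))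

  clockedRec-sound : ∀ {n} (g : PR n) (h : PR (suc (suc n))) {t xs v} k →
                     clockedRec g h t xs k ≡ suc v → Rf g h [ k ∷ xs ]⇓ v
  clockedRec-sound g h zero    p = evR0 (clocked-sound g p)
  clockedRec-sound g h {xs = xs} (suc k) p =
    let (a , rec⇓ , h⇓) = clockedRec-suc⁻ g h {xs = xs} {k} p in evRs (clockedRec-sound g h k rec⇓) (clocked-sound h h⇓)

common-bound : ∀ {P : ℕ → ℕ → Set} → (∀ {t t′ i} → t ≤ t′ → P t i → P t′ i) →
               ∀ y → (∀ i → i < y → ∃ λ t → P t i) → ∃ λ T → ∀ i → i < y → P T i
common-bound mono zero    h = 0 , λ i ()
common-bound mono (suc y) h with common-bound mono y (λ i i<y → h i (m<n⇒m<1+n i<y)) | h y ≤-refl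
... | T , PT | t , Pt = T ⊔ t , λ i i<1+y → below i (m<1+n⇒m<n∨m≡n i<1+y)
  where
  below : ∀ i → i < y ⊎ i ≡ y → _
  below i (inj₁ i<y) = mono (m≤m⊔n T t) (PT i i<y)
  below i (inj₂ refl) = mono (m≤n⊔m T t) Pt

mutual
  clocked-complete : ∀ {n} {e : PR n} {xs v} → e [ xs ]⇓ v → ∃ λ t → clocked e (t ∷ xs) ≡ suc v
  clocked-complete evZ = 0 , refl
  clocked-complete evS = 0 , refl
  clocked-complete evP = 0 , refl
  clocked-complete {e = Cf f gs} (evC gs⇓ f⇓) =
    let (t₁ , p₁) = clocked*-complete gs⇓ ; (t₂ , p₂) = clocked-complete f⇓
    in t₁ ⊔ t₂ , clocked-Cf⁺ f gs (clocked*-mono gs (m≤m⊔n t₁ t₂) p₁) (clocked-mono f (m≤n⊔m t₁ t₂) p₂)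
  clocked-complete (evR0 g⇓) = clocked-complete g⇓
  clocked-complete {e = Rf g h} {suc k ∷ xs} (evRs rec⇓ h⇓) =
    let (t₁ , p₁) = clocked-complete rec⇓ ; (t₂ , p₂) = clocked-complete h⇓
    in t₁ ⊔ t₂ , clockedRec-suc⁺ g h (clockedRec-mono g h (m≤m⊔n t₁ t₂) k p₁) (clocked-mono h (m≤n⊔m t₁ t₂) p₂)
  clocked-complete {e = Mf f} {xs} {y} (evM f⇓0 below) =
    let (t₀ , p₀) = clocked-complete f⇓0
        (T , pT)  = common-bound (λ t≤t′ → map₂ (clocked-mono f t≤t′)) y
                      (λ i i<y → let (v , f⇓) = below i i<y ; (t , p) = clocked-complete f⇓ in t , v , p)
        t = T ⊔ t₀ ⊔ suc y
        T≤t  = ≤-trans (m≤m⊔n T t₀) (m≤m⊔n (T ⊔ t₀) (suc y))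
        t₀≤t = ≤-trans (m≤n⊔m T t₀) (m≤m⊔n (T ⊔ t₀) (suc y))
    in t , clocked-Mf⁺ f (m≤n⊔m (T ⊔ t₀) (suc y))
                        (clocked-mono f t₀≤t p₀ , λ i i<y → map₂ (clocked-mono f T≤t) (pT i i<y))

  clocked*-complete : ∀ {m n} {gs : Vec (PR n) m} {xs ws} → gs [ xs ]⇓* ws → ∃ λ t → clocked* gs (t ∷ xs) ≡ map suc ws
  clocked*-complete ev[] = 0 , refl
  clocked*-complete {gs = g ∷ gs} (ev∷ g⇓ gs⇓) =
    let (t₁ , p₁) = clocked-complete g⇓ ; (t₂ , p₂) = clocked*-complete gs⇓
    in t₁ ⊔ t₂ , cong₂ _∷_ (clocked-mono g (m≤m⊔n t₁ t₂) p₁) (clocked*-mono gs (m≤n⊔m t₁ t₂) p₂)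

⇓-deterministic : ∀ {n} {e : PR n} {xs v w} → e [ xs ]⇓ v → e [ xs ]⇓ w → v ≡ w
⇓-deterministic {e = e} e⇓v e⇓w =
  let (t₁ , p₁) = clocked-complete e⇓v ; (t₂ , p₂) = clocked-complete e⇓w
  in suc-injective (trans (sym (clocked-mono e (m≤m⊔n t₁ t₂) p₁)) (clocked-mono e (m≤n⊔m t₁ t₂) p₂))

-- Binary digits and finite sets

parity : ℕ → ℕ
parity zero    = 0
parity (suc n) = isZero (parity n)

half : ℕ → ℕ
half zero    = 0
half (suc n) = half n + parity n

shiftR : ℕ → ℕ → ℕ
shiftR x zero    = x
shiftR x (suc j) = half (shiftR x j)

bit : ℕ → ℕ → ℕ
bit x j = parity (shiftR x j)

cParity : Comp₁ parity
cParity = cPrimRec cZero (app₁ isZero cIsZero arg₁) (λ _ → refl) (λ _ _ → refl)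

cHalf : Comp₁ half
cHalf = cPrimRec cZero (app₂ _+_ c+ arg₁ (app₁ parity cParity arg₀)) (λ _ → refl) (λ _ _ → refl)

cShiftR : Comp₂ shiftR
cShiftR = cSwap shiftR (cPrimRec arg₀ (app₁ half cHalf arg₁) (λ _ → refl) (λ _ _ → refl))

cBit : Comp₂ bit
cBit = app₁ parity cParity cShiftR

c2^ : Comp₁ (2 ^_)
c2^ = cPrimRec (cConst 1) (app₂ _*_ c* (cConst 2) arg₁) (λ _ → refl) (λ _ _ → refl)

parity≤1 : ∀ n → parity n ≡ 0 ⊎ parity n ≡ 1
parity≤1 zero = inj₁ refl
parity≤1 (suc n) with parity≤1 n
... | inj₁ p≡0 rewrite p≡0 = inj₂ refl
... | inj₂ p≡1 rewrite p≡1 = inj₁ refl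

parity-2+ : ∀ n → parity (2 + n) ≡ parity n
parity-2+ n with parity≤1 n
... | inj₁ p≡0 rewrite p≡0 = refl
... | inj₂ p≡1 rewrite p≡1 = refl

half-2+ : ∀ n → half (2 + n) ≡ suc (half n)
half-2+ n with parity≤1 n
... | inj₁ p≡0 rewrite p≡0 = trans (+-comm (half n + 0) 1) (cong suc (+-identityʳ (half n)))
... | inj₂ p≡1 rewrite p≡1 = trans (+-identityʳ (half n + 1)) (+-comm (half n) 1)

+-double-suc : ∀ x y → x + ((1 + y) + (1 + y)) ≡ 2 + (x + (y + y))
+-double-suc = solve-∀

half-+double : ∀ x y → half (x + (y + y)) ≡ half x + y
half-+double x zero    = trans (cong half (+-identityʳ x)) (sym (+-identityʳ (half x)))
half-+double x (suc y) = begin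
  half (x + (suc y + suc y))   ≡⟨ cong half (+-double-suc x y) ⟩
  half (2 + (x + (y + y)))     ≡⟨ half-2+ (x + (y + y)) ⟩
  suc (half (x + (y + y)))     ≡⟨ cong suc (half-+double x y) ⟩
  suc (half x + y)             ≡⟨ +-suc (half x) y ⟨
  half x + suc y               ∎
  where open ≡-Reasoning

parity-+double : ∀ x y → parity (x + (y + y)) ≡ parity x
parity-+double x zero    = cong parity (+-identityʳ x)
parity-+double x (suc y) = begin
  parity (x + (suc y + suc y)) ≡⟨ cong parity (+-double-suc x y) ⟩
  parity (2 + (x + (y + y)))   ≡⟨ parity-2+ (x + (y + y)) ⟩
  parity (x + (y + y))         ≡⟨ parity-+double x y ⟩
  parity x                     ∎
  where open ≡-Reasoning

parity+double-half : ∀ x → parity x + (half x + half x) ≡ x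
parity+double-half zero = refl
parity+double-half (suc x) with parity≤1 x
... | inj₁ p≡0 rewrite p≡0 =
  cong suc (trans (arith (half x)) (subst (λ p → p + (half x + half x) ≡ x) p≡0 (parity+double-half x)))
  where
  arith : ∀ h → (h + 0) + (h + 0) ≡ 0 + (h + h)
  arith = solve-∀
... | inj₂ p≡1 rewrite p≡1 =
  trans (arith (half x)) (cong suc (subst (λ p → p + (half x + half x) ≡ x) p≡1 (parity+double-half x)))
  where
  arith : ∀ h → (h + 1) + (h + 1) ≡ 1 + (1 + (h + h))
  arith = solve-∀

half-< : ∀ x y → x < y + y → half x < y
half-< x y x<2y with half x <? y
... | yes h<y = h<y
... | no  h≮y = ⊥-elim (<-irrefl refl (≤-<-trans 2y≤x x<2y))
  where
  2y≤x : y + y ≤ x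
  2y≤x = begin
    y + y                             ≤⟨ +-mono-≤ (≮⇒≥ h≮y) (≮⇒≥ h≮y) ⟩
    half x + half x                   ≤⟨ m≤n+m (half x + half x) (parity x) ⟩
    parity x + (half x + half x)      ≡⟨ parity+double-half x ⟩
    x                                 ∎
    where open ≤-Reasoning

shiftR-half : ∀ x j → shiftR (half x) j ≡ half (shiftR x j)
shiftR-half x zero    = refl
shiftR-half x (suc j) = cong half (shiftR-half x j)

shiftR-0 : ∀ j → shiftR 0 j ≡ 0
shiftR-0 zero    = refl
shiftR-0 (suc j) = cong half (shiftR-0 j)

shiftR-small : ∀ x j → x < 2 ^ j → shiftR x j ≡ 0
shiftR-small x zero    x<1   = n<1⇒n≡0 x<1
shiftR-small x (suc j) x<2^j = trans (sym (shiftR-half x j)) (shiftR-small (half x) j (half-< x (2 ^ j) x<2^j′))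
  where
  x<2^j′ : x < 2 ^ j + 2 ^ j
  x<2^j′ = subst (x <_) (cong (2 ^ j +_) (+-identityʳ (2 ^ j))) x<2^j

shiftR-+ : ∀ x j c → shiftR (x + 2 ^ j * c) j ≡ shiftR x j + c
shiftR-+ x zero    c = cong (x +_) (*-identityˡ c)
shiftR-+ x (suc j) c = begin
  half (shiftR (x + 2 ^ suc j * c) j)    ≡⟨ cong (λ z → half (shiftR (x + z) j)) (arith (2 ^ j) c) ⟩
  half (shiftR (x + 2 ^ j * (c + c)) j)  ≡⟨ cong half (shiftR-+ x j (c + c)) ⟩
  half (shiftR x j + (c + c))            ≡⟨ half-+double (shiftR x j) c ⟩
  half (shiftR x j) + c                  ∎
  where
  open ≡-Reasoning
  arith : ∀ a c → 2 * a * c ≡ a * (c + c)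
  arith = solve-∀

bit-0 : ∀ j → bit 0 j ≡ 0
bit-0 j = cong parity (shiftR-0 j)

bit-below : ∀ x t c j → j < t → bit (x + 2 ^ t * c) j ≡ bit x j
bit-below x t c j j<t with m≤n⇒∃[o]m+o≡n j<t
... | k , refl = begin
  parity (shiftR (x + 2 ^ (suc j + k) * c) j)   ≡⟨ cong (λ z → parity (shiftR (x + z) j)) split ⟩
  parity (shiftR (x + 2 ^ j * (d + d)) j)       ≡⟨ cong parity (shiftR-+ x j (d + d)) ⟩
  parity (shiftR x j + (d + d))                 ≡⟨ parity-+double (shiftR x j) d ⟩
  parity (shiftR x j)                           ∎
  where
  open ≡-Reasoning
  d = 2 ^ k * c
  arith : ∀ a b c → 2 * (a * b) * c ≡ a * (b * c + b * c)
  arith = solve-∀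
  split : 2 ^ (suc j + k) * c ≡ 2 ^ j * (d + d)
  split = trans (cong (λ z → 2 * z * c) (^-distribˡ-+-* 2 j k)) (arith (2 ^ j) (2 ^ k) c)

bit-at : ∀ x t c → x < 2 ^ t → bit (x + 2 ^ t * c) t ≡ parity c
bit-at x t c x<2^t rewrite shiftR-+ x t c | shiftR-small x t x<2^t = refl

fromBits : (ℕ → Bool) → ℕ → ℕ
fromBits p zero    = 0
fromBits p (suc t) = fromBits p t + 2 ^ t * fromBool (p t)

cFromBits : ∀ {n} {p : Vec ℕ (suc n) → Bool} → CompB (suc n) p →
            Comp (suc n) (λ xs → fromBits (λ m → p (m ∷ tail xs)) (lookup xs zero))
cFromBits cp = cPrimRec cZero (app₂ _+_ c+ arg₁ (app₂ _*_ c* (app₁ (2 ^_) c2^ arg₀) (cSkip₁ cp)))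
                        (λ _ → refl) (λ _ _ → refl)

fromBits<2^ : ∀ p t → fromBits p t < 2 ^ t
fromBits<2^ p zero    = s≤s z≤n
fromBits<2^ p (suc t) = begin-strict
  fromBits p t + 2 ^ t * fromBool (p t)  <⟨ +-mono-<-≤ (fromBits<2^ p t) (*-monoʳ-≤ (2 ^ t) (fromBool≤1 (p t))) ⟩
  2 ^ t + 2 ^ t * 1                      ≡⟨ cong (2 ^ t +_) (*-identityʳ (2 ^ t)) ⟩
  2 ^ t + 2 ^ t                          ≡⟨ cong (2 ^ t +_) (+-identityʳ (2 ^ t)) ⟨
  2 ^ suc t                              ∎
  where
  open ≤-Reasoning
  fromBool≤1 : ∀ b → fromBool b ≤ 1
  fromBool≤1 true  = ≤-refl
  fromBool≤1 false = z≤n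

bit-fromBits : ∀ p t j → j < t → bit (fromBits p t) j ≡ fromBool (p j)
bit-fromBits p (suc t) j j<1+t with m<1+n⇒m<n∨m≡n j<1+t
... | inj₁ j<t  = trans (bit-below (fromBits p t) t (fromBool (p t)) j j<t) (bit-fromBits p t j j<t)
... | inj₂ refl = trans (bit-at (fromBits p t) t (fromBool (p t)) (fromBits<2^ p t)) (parity-fromBool (p t))
  where
  parity-fromBool : ∀ b → parity (fromBool b) ≡ fromBool b
  parity-fromBool true  = refl
  parity-fromBool false = refl

bit-fromBits-≥ : ∀ p t j → t ≤ j → bit (fromBits p t) j ≡ 0
bit-fromBits-≥ p t j t≤j =
  cong parity (shiftR-small (fromBits p t) j (<-≤-trans (fromBits<2^ p t) (^-monoʳ-≤ 2 t≤j)))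

count< : ℕ → (ℕ → Bool) → ℕ
count< zero    p = 0
count< (suc b) p = count< b p + fromBool (p b)

cCount< : ∀ {n} {p : Vec ℕ (suc n) → Bool} → CompB (suc n) p →
          Comp (suc n) (λ xs → count< (lookup xs zero) (λ i → p (i ∷ tail xs)))
cCount< cp = cPrimRec cZero (app₂ _+_ c+ arg₁ (cSkip₁ cp)) (λ _ → refl) (λ _ _ → refl)

count<-all : ∀ b p → (∀ i → i < b → p i ≡ true) → count< b p ≡ b
count<-all zero    p all = refl
count<-all (suc b) p all rewrite count<-all b p (λ i i<b → all i (m<n⇒m<1+n i<b)) | all b ≤-refl = +-comm b 1

count<-none-from : ∀ x d p → (∀ i → x ≤ i → p i ≡ false) → count< (x + d) p ≡ count< x p
count<-none-from x zero    p none = cong (λ b → count< b p) (+-identityʳ x)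
count<-none-from x (suc d) p none rewrite +-suc x d | none (x + d) (m≤m+n x d) =
  trans (+-identityʳ _) (count<-none-from x d p none)

-- The number of j < c for which the bits 0, …, j of c all vanish: the exponent of 2 in c.
codeHead : ℕ → ℕ
codeHead c = count< c (λ j → all< (suc j) (λ i → bit c i ≡ᵇ 0))

codeTail : ℕ → ℕ
codeTail c = shiftR c (suc (codeHead c))

cCodeHead : Comp₁ codeHead
cCodeHead = cComp (cCount< lowBitsZero) (c∷ arg₀ (c∷ arg₀ c[]))
  where
  lowBitsZero : CompB 2 (λ v → all< (suc (lookup v zero)) (λ i → bit (lookup v (suc zero)) i ≡ᵇ 0))
  lowBitsZero = cComp (cAll< (c≡ᵇ (app₂ bit cBit arg₁ arg₀) (cConst 0))) (c∷ (app₁ suc cSuc arg₀) (c∷ arg₁ c[]))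

cCodeTail : Comp₁ codeTail
cCodeTail = app₂ shiftR cShiftR arg₀ (app₁ suc cSuc (app₁ codeHead cCodeHead arg₀))

codeHead-lowestBit : ∀ c x → bit c x ≡ 1 → (∀ i → i < x → bit c i ≡ 0) → x < c → codeHead c ≡ x
codeHead-lowestBit c x bx≡1 below x<c with m≤n⇒∃[o]m+o≡n (<⇒≤ x<c)
... | d , refl = trans (count<-none-from x d lowZero none) (count<-all x lowZero all)
  where
  lowZero : ℕ → Bool
  lowZero j = all< (suc j) (λ i → bit (x + d) i ≡ᵇ 0)
  all : ∀ j → j < x → lowZero j ≡ true
  all j j<x = all<-true⁺ (suc j) _ λ i i≤j →
    subst (λ b → (b ≡ᵇ 0) ≡ true) (sym (below i (≤-<-trans (s≤s⁻¹ i≤j) j<x))) refl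
  none : ∀ j → x ≤ j → lowZero j ≡ false
  none j x≤j = all<-false⁺ (suc j) _ x (s≤s x≤j) (subst (λ b → (b ≡ᵇ 0) ≡ false) (sym bx≡1) refl)

n<2^n : ∀ n → n < 2 ^ n
n<2^n zero    = s≤s z≤n
n<2^n (suc n) = begin-strict
  suc n          <⟨ +-mono-≤ (m^n>0 2 n) (n<2^n n) ⟩
  2 ^ n + 2 ^ n  ≡⟨ cong (2 ^ n +_) (+-identityʳ (2 ^ n)) ⟨
  2 ^ suc n      ∎
  where open ≤-Reasoning

parity-odd : ∀ c → parity (suc (2 * c)) ≡ 1
parity-odd c rewrite +-identityʳ c | parity-+double 0 c = refl

half-odd : ∀ c → half (suc (2 * c)) ≡ c
half-odd c rewrite +-identityʳ c | parity-+double 0 c | half-+double 0 c = +-identityʳ c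

x<code-∷ : ∀ x l → x < code (x ∷ l)
x<code-∷ x l = <-≤-trans (n<2^n x) (m≤m*n (2 ^ x) (suc (2 * code l)))

codeHead-code : ∀ x l → codeHead (code (x ∷ l)) ≡ x
codeHead-code x l = codeHead-lowestBit (code (x ∷ l)) x bit-x below (x<code-∷ x l)
  where
  bit-x : bit (code (x ∷ l)) x ≡ 1
  bit-x = trans (bit-at 0 x (suc (2 * code l)) (m^n>0 2 x)) (parity-odd (code l))
  below : ∀ i → i < x → bit (code (x ∷ l)) i ≡ 0
  below i i<x = trans (bit-below 0 x (suc (2 * code l)) i i<x) (bit-0 i)

codeTail-code : ∀ l → codeTail (code l) ≡ code (drop 1 l)
codeTail-code []      = shiftR-0 (suc (codeHead 0))
codeTail-code (x ∷ l) rewrite codeHead-code x l | shiftR-+ 0 x (suc (2 * code l)) | shiftR-0 x = half-odd (code l)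

length≤code : ∀ l → length l ≤ code l
length≤code []      = z≤n
length≤code (x ∷ l) = begin
  suc (length l)          ≤⟨ s≤s (≤-trans (length≤code l) (m≤m+n (code l) _)) ⟩
  suc (2 * code l)        ≤⟨ m≤n*m (suc (2 * code l)) (2 ^ x) {{m^n≢0 2 x}} ⟩
  2 ^ x * suc (2 * code l) ∎
  where open ≤-Reasoning

code-∷>0 : ∀ x l → 0 < code (x ∷ l)
code-∷>0 x l = ≤-<-trans z≤n (x<code-∷ x l)

codeDrop : ℕ → ℕ → ℕ
codeDrop c zero    = c
codeDrop c (suc k) = codeTail (codeDrop c k)

cCodeDrop : Comp₂ codeDrop
cCodeDrop = cSwap codeDrop (cPrimRec arg₀ (app₁ codeTail cCodeTail arg₁) (λ _ → refl) (λ _ _ → refl))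

codeDrop-code : ∀ l k → codeDrop (code l) k ≡ code (drop k l)
codeDrop-code l zero    = refl
codeDrop-code l (suc k) = begin
  codeTail (codeDrop (code l) k)  ≡⟨ cong codeTail (codeDrop-code l k) ⟩
  codeTail (code (drop k l))      ≡⟨ codeTail-code (drop k l) ⟩
  code (drop 1 (drop k l))        ≡⟨ cong code (drop-drop k 1 l) ⟩
  code (drop (k + 1) l)           ≡⟨ cong (λ j → code (drop j l)) (+-comm k 1) ⟩
  code (drop (suc k) l)           ∎
  where open ≡-Reasoning

allMarked : ℕ → ℕ → Bool
allMarked B c = all< c (λ k → (codeDrop c k ≡ᵇ 0) ∨ (bit B (codeHead (codeDrop c k)) ≡ᵇ 1))

cAllMarked : CompB 2 (λ v → allMarked (lookup v zero) (lookup v (suc zero)))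
cAllMarked = cComp (cAll< markedAt) (c∷ arg₁ (c∷ arg₀ (c∷ arg₁ c[])))
  where
  markedAt : CompB 3 (λ v → (codeDrop (lookup v (suc (suc zero))) (lookup v zero) ≡ᵇ 0) ∨
                            (bit (lookup v (suc zero)) (codeHead (codeDrop (lookup v (suc (suc zero))) (lookup v zero))) ≡ᵇ 1))
  markedAt = c∨ (c≡ᵇ (app₂ codeDrop cCodeDrop arg₂ arg₀) (cConst 0))
                (c≡ᵇ (app₂ bit cBit arg₁ (app₁ codeHead cCodeHead (app₂ codeDrop cCodeDrop arg₂ arg₀))) (cConst 1))

All-from-drops : ∀ {P : ℕ → Set} l → (∀ k {x l′} → drop k l ≡ x ∷ l′ → P x) → All P l
All-from-drops []      h = []
All-from-drops (y ∷ l) h = h 0 refl ∷ All-from-drops l (λ k → h (suc k))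

allMarked-sound : ∀ B l → allMarked B (code l) ≡ true → All (λ x → bit B x ≡ 1) l
allMarked-sound B l marked = All-from-drops l entry
  where
  entry : ∀ k {x l′} → drop k l ≡ x ∷ l′ → bit B x ≡ 1
  entry k {x} {l′} drop≡ with k <? length l
  ... | yes k<len with ∨-true⁻ (all<-true⁻ (code l) _ marked k (<-≤-trans k<len (length≤code l)))
  ...   | inj₁ empty = ⊥-elim (<-irrefl (trans (sym (≡ᵇ-true⁻ empty)) (trans (codeDrop-code l k) (cong code drop≡)))
                                        (code-∷>0 x l′))
  ...   | inj₂ head  rewrite codeDrop-code l k | drop≡ | codeHead-code x l′ = ≡ᵇ-true⁻ head
  entry k drop≡ | no k≮len with trans (sym (drop-all k l (≮⇒≥ k≮len))) drop≡
  ... | ()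

allMarked-complete : ∀ B l → All (λ x → bit B x ≡ 1) l → allMarked B (code l) ≡ true
allMarked-complete B l all = all<-true⁺ (code l) _ λ k _ → entry k
  where
  entry : ∀ k → ((codeDrop (code l) k ≡ᵇ 0) ∨ (bit B (codeHead (codeDrop (code l) k)) ≡ᵇ 1)) ≡ true
  entry k rewrite codeDrop-code l k with drop k l | drop⁺ k all
  ... | []     | []       = refl
  ... | x ∷ l′ | marked ∷ _ rewrite codeHead-code x l′ | marked = ∨-trueʳ {code (x ∷ l′) ≡ᵇ 0} refl

-- Semi-decision procedures

haltsWithin : PR 1 → ℕ → ℕ → Bool
haltsWithin e t n = 0 <ᵇ clocked e (t ∷ n ∷ [])

cHaltsWithin : ∀ e → CompB 2 (λ v → haltsWithin e (lookup v zero) (lookup v (suc zero)))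
cHaltsWithin e = Comp-ext (c<ᵇ (cConst 0) (cClocked e)) λ { (t ∷ n ∷ []) → refl }

positive⇒suc : ∀ {r} → (0 <ᵇ r) ≡ true → ∃ λ v → r ≡ suc v
positive⇒suc {suc r} _ = r , refl

haltsWithin-mono : ∀ e {t t′ n} → t ≤ t′ → haltsWithin e t n ≡ true → haltsWithin e t′ n ≡ true
haltsWithin-mono e t≤t′ h with positive⇒suc h
... | v , e⇓ rewrite clocked-mono e t≤t′ e⇓ = refl

haltsWithin-sound : ∀ e {t n} → haltsWithin e t n ≡ true → ∃ λ v → e [ n ∷ [] ]⇓ v
haltsWithin-sound e h = map₂ (clocked-sound e) (positive⇒suc h)

haltsWithin-complete : ∀ e {n} → (∃ λ v → e [ n ∷ [] ]⇓ v) → ∃ λ t → haltsWithin e t n ≡ true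
haltsWithin-complete e (v , e⇓) with clocked-complete e⇓
... | t , p = t , cong (0 <ᵇ_) p

-- A semi-decision procedure for a family A a of predicates, uniform in the parameter a:
-- accepts t a m searches for evidence of A a m up to the bound t.
record SemiDecider (A : ℕ → ℕ → Set) : Set where
  field
    accepts    : ℕ → ℕ → ℕ → Bool
    computable : CompB 3 (λ v → accepts (lookup v zero) (lookup v (suc zero)) (lookup v (suc (suc zero))))
    monotone   : ∀ {t t′ a m} → t ≤ t′ → accepts t a m ≡ true → accepts t′ a m ≡ true
    sound      : ∀ {t a m} → accepts t a m ≡ true → A a m
    complete   : ∀ {a m} → A a m → ∃ λ t → accepts t a m ≡ true

RE⇒SemiDecider : ∀ {Y} → RE Y → SemiDecider (λ _ → Y)
RE⇒SemiDecider (e , e-dom) = record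
  { accepts    = λ t _ m → haltsWithin e t m
  ; computable = cComp (cHaltsWithin e) (c∷ arg₀ (c∷ arg₂ c[]))
  ; monotone   = haltsWithin-mono e
  ; sound      = λ h → Equivalence.from (e-dom _) (haltsWithin-sound e h)
  ; complete   = λ y → haltsWithin-complete e (Equivalence.to (e-dom _) y)
  }

SemiDecider-resp : ∀ {A B : ℕ → ℕ → Set} → (∀ {a m} → A a m → B a m) → (∀ {a m} → B a m → A a m) →
                   SemiDecider A → SemiDecider B
SemiDecider-resp A⇒B B⇒A D = record
  { accepts = accepts ; computable = computable ; monotone = monotone
  ; sound = λ h → A⇒B (sound h) ; complete = λ b → complete (B⇒A b) }
  where open SemiDecider D

SemiDecider-adjoin : ∀ {A} → SemiDecider A → SemiDecider (λ a m → A a m ⊎ m ≡ a)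
SemiDecider-adjoin {A} D = record
  { accepts    = accepts′
  ; computable = c∨ computable (c≡ᵇ arg₂ arg₁)
  ; monotone   = mono
  ; sound      = sound′
  ; complete   = complete′
  }
  where
  open SemiDecider D
  accepts′ : ℕ → ℕ → ℕ → Bool
  accepts′ t a m = accepts t a m ∨ (m ≡ᵇ a)
  mono : ∀ {t t′ a m} → t ≤ t′ → accepts′ t a m ≡ true → accepts′ t′ a m ≡ true
  mono {t} {t′} {a} {m} t≤t′ h with ∨-true⁻ {accepts t a m} h
  ... | inj₁ acc = ∨-trueˡ (monotone t≤t′ acc)
  ... | inj₂ eq  = ∨-trueʳ {accepts t′ a m} eq
  sound′ : ∀ {t a m} → accepts′ t a m ≡ true → A a m ⊎ m ≡ a
  sound′ {t} {a} {m} h with ∨-true⁻ {accepts t a m} h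
  ... | inj₁ acc = inj₁ (sound acc)
  ... | inj₂ eq  = inj₂ (≡ᵇ-true⁻ eq)
  complete′ : ∀ {a m} → A a m ⊎ m ≡ a → ∃ λ t → accepts′ t a m ≡ true
  complete′ (inj₁ h) = map₂ ∨-trueˡ (complete h)
  complete′ {a} (inj₂ refl) = 0 , ∨-trueʳ {accepts 0 a a} (≡ᵇ-true⁺ {a} refl)

SemiDecider-meets : ∀ {A B} → SemiDecider A → SemiDecider (λ _ → B) →
                    SemiDecider (λ _ a → ∃ λ z → A a z × B z)
SemiDecider-meets {A} {B} DA DB = record
  { accepts    = accepts
  ; computable = cComp (cAny< (c∧ (cComp (SemiDecider.computable DA) (c∷ arg₁ (c∷ arg₃ (c∷ arg₀ c[]))))
                                  (cComp (SemiDecider.computable DB) (c∷ arg₁ (c∷ arg₃ (c∷ arg₀ c[]))))))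
                       (c∷ arg₀ (c∷ arg₀ (c∷ arg₁ (c∷ arg₂ c[]))))
  ; monotone   = λ {t} {t′} {p} {a} → mono {t} {t′} {p} {a}
  ; sound      = λ {t} {p} {a} → sound {t} {p} {a}
  ; complete   = λ {p} {a} → complete {p} {a}
  }
  where
  module A = SemiDecider DA
  module B = SemiDecider DB
  both : ℕ → ℕ → ℕ → Bool
  both t a z = A.accepts t a z ∧ B.accepts t a z
  accepts : ℕ → ℕ → ℕ → Bool
  accepts t _ a = any< t (both t a)
  mono : ∀ {t t′ p a} → t ≤ t′ → accepts t p a ≡ true → accepts t′ p a ≡ true
  mono {t} {t′} t≤t′ h with any<-true⁻ t _ h
  ... | z , z<t , both-z with ∧-true⁻ both-z
  ...   | az , bz = any<-true⁺ t′ _ z (<-≤-trans z<t t≤t′) (∧-true⁺ (A.monotone t≤t′ az) (B.monotone t≤t′ bz))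
  sound : ∀ {t p a} → accepts t p a ≡ true → ∃ λ z → A a z × B z
  sound {t} h with any<-true⁻ t _ h
  ... | z , _ , both-z = let (az , bz) = ∧-true⁻ both-z in z , A.sound az , B.sound bz
  complete : ∀ {p a} → (∃ λ z → A a z × B z) → ∃ λ t → accepts t p a ≡ true
  complete (z , az , bz) with A.complete az | B.complete bz
  ... | tA , hA | tB , hB = t , any<-true⁺ t _ z z<t (∧-true⁺ (A.monotone tA≤t hA) (B.monotone tB≤t hB))
    where
    t = tA ⊔ tB ⊔ suc z
    z<t  = m≤n⊔m (tA ⊔ tB) (suc z)
    tA≤t = ≤-trans (m≤m⊔n tA tB) (m≤m⊔n (tA ⊔ tB) (suc z))
    tB≤t = ≤-trans (m≤n⊔m tA tB) (m≤m⊔n (tA ⊔ tB) (suc z))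

module Dovetailing (em : ExcludedMiddle 0ℓ) {X : Subset}
                   (D⁺ : SemiDecider (λ _ → X)) (D⁻ : SemiDecider (λ _ n → ¬ X n)) where

  private
    module P = SemiDecider D⁺
    module N = SemiDecider D⁻

  settled : ℕ → ℕ → Bool
  settled n t = P.accepts t 0 n ∨ N.accepts t 0 n

  cAccepted : CompB 2 (λ v → P.accepts (lookup v zero) 0 (lookup v (suc zero)))
  cAccepted = cComp P.computable (c∷ arg₀ (c∷ (cConst 0) (c∷ arg₁ c[])))

  cUnsettled : CompB 2 (λ v → not (settled (lookup v (suc zero)) (lookup v zero)))
  cUnsettled = cNot (c∨ cAccepted (cComp N.computable (c∷ arg₀ (c∷ (cConst 0) (c∷ arg₁ c[])))))

  unsettled : PR 2
  unsettled = proj₁ cUnsettled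

  -- decider n returns the verdict of D⁺ at the least t at which D⁺ or D⁻ accepts n.
  decider : PR 1
  decider = Cf (proj₁ cAccepted) (Mf unsettled ∷ Pf zero ∷ [])

  unsettled⇓ : ∀ t n → unsettled [ t ∷ n ∷ [] ]⇓ fromBool (not (settled n t))
  unsettled⇓ t n = proj₂ cUnsettled (t ∷ n ∷ [])

  decider⇓ : ∀ n t → settled n t ≡ true → (∀ i → i < t → settled n i ≡ false) →
             decider [ n ∷ [] ]⇓ fromBool (P.accepts t 0 n)
  decider⇓ n t settled-t unsettled-below =
    evC (ev∷ (evM at-t below) (ev∷ evP ev[])) (proj₂ cAccepted (t ∷ n ∷ []))
    where
    at-t : unsettled [ t ∷ n ∷ [] ]⇓ 0
    at-t = subst (λ b → unsettled [ t ∷ n ∷ [] ]⇓ fromBool (not b)) settled-t (unsettled⇓ t n)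
    below : ∀ i → i < t → ∃ λ v → unsettled [ i ∷ n ∷ [] ]⇓ suc v
    below i i<t = 0 , subst (λ b → unsettled [ i ∷ n ∷ [] ]⇓ fromBool (not b)) (unsettled-below i i<t) (unsettled⇓ i n)

  eventually-settled : ∀ n → ∃ λ t → settled n t ≡ true
  eventually-settled n with em {X n}
  ... | yes x  = map₂ ∨-trueˡ (P.complete x)
  ... | no  ¬x = let (t , h) = N.complete ¬x in t , ∨-trueʳ {P.accepts t 0 n} h

  decides-at : ∀ n t → settled n t ≡ true → (∀ i → i < t → settled n i ≡ false) →
               (X n → decider [ n ∷ [] ]⇓ 1) × (¬ X n → decider [ n ∷ [] ]⇓ 0)
  decides-at n t settled-t unsettled-below =
      (λ x → subst (λ b → decider [ n ∷ [] ]⇓ fromBool b) (accepted x) d)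
    , (λ ¬x → subst (λ b → decider [ n ∷ [] ]⇓ fromBool b) (rejected ¬x) d)
    where
    d = decider⇓ n t settled-t unsettled-below
    accepted : X n → P.accepts t 0 n ≡ true
    accepted x with ∨-true⁻ {P.accepts t 0 n} settled-t
    ... | inj₁ acc = acc
    ... | inj₂ rej = ⊥-elim (N.sound rej x)
    rejected : ¬ X n → P.accepts t 0 n ≡ false
    rejected ¬x with P.accepts t 0 n in acc
    ... | true  = ⊥-elim (¬x (P.sound acc))
    ... | false = refl

  decides : ∀ n → (X n → decider [ n ∷ [] ]⇓ 1) × (¬ X n → decider [ n ∷ [] ]⇓ 0)
  decides n =
    let (t₀ , settled-t₀) = eventually-settled n
        (t , settled-t , unsettled-below) = least-true (settled n) t₀ settled-t₀
    in decides-at n t settled-t unsettled-below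

SemiDeciders⇒Computable : ExcludedMiddle 0ℓ → ∀ {X} →
                          SemiDecider (λ _ → X) → SemiDecider (λ _ n → ¬ X n) → Computable X
SemiDeciders⇒Computable em D⁺ D⁻ = decider , decides
  where open Dovetailing em D⁺ D⁻

-- Derivations

data Derivable (S : List ℕ → Set) (A : ℕ → Set) : ℕ → Set where
  base : ∀ {m} → A m → Derivable S A m
  rule : ∀ {m ms} → S (m ∷ ms) → All (Derivable S A) ms → Derivable S A m

module DerivationSearch {S : List ℕ → Set} (S-re : REList S) {A : ℕ → ℕ → Set} (DA : SemiDecider A) where

  private
    module A = SemiDecider DA
    es = proj₁ S-re

  rule-sound : ∀ {t c} → haltsWithin es t c ≡ true → Σ (List ℕ) λ l → code l ≡ c × S l
  rule-sound h = Equivalence.from (proj₂ S-re _) (haltsWithin-sound es h)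

  rule-complete : ∀ {l} → S l → ∃ λ t → haltsWithin es t (code l) ≡ true
  rule-complete s = haltsWithin-complete es (Equivalence.to (proj₂ S-re _) (_ , refl , s))

  fires : ℕ → ℕ → ℕ → ℕ → Bool
  fires t B m c = haltsWithin es t c ∧ ((codeHead c ≡ᵇ m) ∧ (allMarked B (codeTail c) ∧ (0 <ᵇ c)))

  step : ℕ → ℕ → ℕ → ℕ → Bool
  step t a B m = (bit B m ≡ᵇ 1) ∨ (A.accepts t a m ∨ any< t (fires t B m))

  -- The set of elements below t derived in k rounds from the base elements and the
  -- rules that are accepted within t.
  stage : ℕ → ℕ → ℕ → ℕ
  stage t a zero    = 0
  stage t a (suc k) = fromBits (step t a (stage t a k)) t

  accepts : ℕ → ℕ → ℕ → Bool
  accepts t a m = (m <ᵇ t) ∧ (bit (stage t a t) m ≡ᵇ 1)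

  cFires : CompB 4 (λ v → fires (lookup v (suc zero)) (lookup v (suc (suc zero))) (lookup v (suc (suc (suc zero)))) (lookup v zero))
  cFires = c∧ (cComp (cHaltsWithin es) (c∷ arg₁ (c∷ arg₀ c[])))
              (c∧ (c≡ᵇ (app₁ codeHead cCodeHead arg₀) arg₃)
                  (c∧ (cComp cAllMarked (c∷ arg₂ (c∷ (app₁ codeTail cCodeTail arg₀) c[]))) (c<ᵇ (cConst 0) arg₀)))

  cStep : CompB 4 (λ v → step (lookup v (suc (suc zero))) (lookup v (suc (suc (suc zero)))) (lookup v (suc zero)) (lookup v zero))
  cStep = c∨ (c≡ᵇ (app₂ bit cBit arg₁ arg₀) (cConst 1))
             (c∨ (cComp A.computable (c∷ arg₂ (c∷ arg₃ (c∷ arg₀ c[]))))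
                 (cComp (cAny< cFires) (c∷ arg₂ (c∷ arg₂ (c∷ arg₁ (c∷ arg₀ c[]))))))

  cStage : Comp 3 (λ v → stage (lookup v (suc zero)) (lookup v (suc (suc zero))) (lookup v zero))
  cStage = cPrimRec cZero (cComp (cFromBits cStep) (c∷ arg₂ (c∷ arg₁ (c∷ arg₂ (c∷ arg₃ c[])))))
                    (λ _ → refl) (λ _ _ → refl)

  cAccepts : CompB 3 (λ v → accepts (lookup v zero) (lookup v (suc zero)) (lookup v (suc (suc zero))))
  cAccepts = c∧ (c<ᵇ arg₂ arg₀) (c≡ᵇ (app₂ bit cBit (cComp cStage (c∷ arg₀ (c∷ arg₀ (c∷ arg₁ c[])))) arg₂) (cConst 1))

  fires⁻ : ∀ t B m → any< t (fires t B m) ≡ true →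
           ∃ λ ms → S (m ∷ ms) × code (m ∷ ms) < t × haltsWithin es t (code (m ∷ ms)) ≡ true ×
                    All (λ x → bit B x ≡ 1) ms
  fires⁻ t B m h with any<-true⁻ t _ h
  ... | c , c<t , f with ∧-true⁻ {haltsWithin es t c} f
  ... | halts , f′ with ∧-true⁻ {codeHead c ≡ᵇ m} f′ | rule-sound halts
  ... | head , f″ | [] , refl , s with ∧-true⁻ {allMarked B (codeTail 0)} f″
  ...   | _ , ()
  fires⁻ t B m h | c , c<t , f | halts , f′ | head , f″ | y ∷ ms , refl , s
    with ∧-true⁻ {allMarked B (codeTail (code (y ∷ ms)))} f″ | trans (sym (codeHead-code y ms)) (≡ᵇ-true⁻ head)
  ... | marked , _ | refl =
    ms , s , c<t , halts , allMarked-sound B ms (subst (λ c′ → allMarked B c′ ≡ true) (codeTail-code (m ∷ ms)) marked)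

  fires⁺ : ∀ t B m {ms} → haltsWithin es t (code (m ∷ ms)) ≡ true → code (m ∷ ms) < t →
           All (λ x → bit B x ≡ 1) ms → any< t (fires t B m) ≡ true
  fires⁺ t B m {ms} halts c<t marked =
    any<-true⁺ t _ (code (m ∷ ms)) c<t (∧-true⁺ halts (∧-true⁺ head (∧-true⁺ marked′ (<ᵇ-true⁺ (code-∷>0 m ms)))))
    where
    head : (codeHead (code (m ∷ ms)) ≡ᵇ m) ≡ true
    head = ≡ᵇ-true⁺ (codeHead-code m ms)
    marked′ : allMarked B (codeTail (code (m ∷ ms))) ≡ true
    marked′ = subst (λ c → allMarked B c ≡ true) (sym (codeTail-code (m ∷ ms))) (allMarked-complete B ms marked)
  stage-< : ∀ t a k m → bit (stage t a k) m ≡ 1 → m < t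
  stage-< t a zero    m marked = ⊥-elim (0≢1+n (trans (sym (bit-0 m)) marked))
  stage-< t a (suc k) m marked with m <? t
  ... | yes m<t = m<t
  ... | no  m≮t = ⊥-elim (0≢1+n (trans (sym (bit-fromBits-≥ _ t m (≮⇒≥ m≮t))) marked))

  stage-suc⁻ : ∀ t a k m → bit (stage t a (suc k)) m ≡ 1 → step t a (stage t a k) m ≡ true
  stage-suc⁻ t a k m marked = fromBool≡1⁻ (trans (sym (bit-fromBits _ t m (stage-< t a (suc k) m marked))) marked)

  stage-suc⁺ : ∀ t a k m → m < t → step t a (stage t a k) m ≡ true → bit (stage t a (suc k)) m ≡ 1
  stage-suc⁺ t a k m m<t st = trans (bit-fromBits _ t m m<t) (cong fromBool st)

  stage-sound : ∀ t a k m → bit (stage t a k) m ≡ 1 → Derivable S (A a) m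
  stage-sound t a zero    m marked = ⊥-elim (0≢1+n (trans (sym (bit-0 m)) marked))
  stage-sound t a (suc k) m marked with ∨-true⁻ {bit (stage t a k) m ≡ᵇ 1} (stage-suc⁻ t a k m marked)
  ... | inj₁ earlier = stage-sound t a k m (≡ᵇ-true⁻ earlier)
  ... | inj₂ new with ∨-true⁻ {A.accepts t a m} new
  ...   | inj₁ accepted = base (A.sound accepted)
  ...   | inj₂ fired    =
    let (ms , s , _ , _ , marked′) = fires⁻ t (stage t a k) m fired in rule s (All-map (λ {x} → stage-sound t a k x) marked′)

  stage-suc-mono : ∀ t a k m → bit (stage t a k) m ≡ 1 → bit (stage t a (suc k)) m ≡ 1
  stage-suc-mono t a k m marked = stage-suc⁺ t a k m (stage-< t a k m marked) (∨-trueˡ (≡ᵇ-true⁺ marked))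

  stage-mono-rounds : ∀ t a {k k′} m → k ≤ k′ → bit (stage t a k) m ≡ 1 → bit (stage t a k′) m ≡ 1
  stage-mono-rounds t a {k′ = zero}   m z≤n  marked = marked
  stage-mono-rounds t a {k′ = suc k′} m k≤ marked with m≤n⇒m<n∨m≡n k≤
  ... | inj₁ (s≤s k≤k′) = stage-suc-mono t a k′ m (stage-mono-rounds t a m k≤k′ marked)
  ... | inj₂ refl       = marked

  stage-mono-clock : ∀ {t t′} a k m → t ≤ t′ → bit (stage t a k) m ≡ 1 → bit (stage t′ a k) m ≡ 1
  stage-mono-clock          a zero    m t≤t′ marked = marked
  stage-mono-clock {t} {t′} a (suc k) m t≤t′ marked =
    stage-suc⁺ t′ a k m (<-≤-trans (stage-< t a (suc k) m marked) t≤t′) (step-mono (stage-suc⁻ t a k m marked))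
    where
    step-mono : step t a (stage t a k) m ≡ true → step t′ a (stage t′ a k) m ≡ true
    step-mono st with ∨-true⁻ {bit (stage t a k) m ≡ᵇ 1} st
    ... | inj₁ earlier = ∨-trueˡ (≡ᵇ-true⁺ (stage-mono-clock a k m t≤t′ (≡ᵇ-true⁻ earlier)))
    ... | inj₂ new with ∨-true⁻ {A.accepts t a m} new
    ...   | inj₁ accepted = ∨-trueʳ {bit (stage t′ a k) m ≡ᵇ 1} (∨-trueˡ (A.monotone t≤t′ accepted))
    ...   | inj₂ fired    =
      let (ms , _ , c<t , halts , marked′) = fires⁻ t (stage t a k) m fired
      in ∨-trueʳ {bit (stage t′ a k) m ≡ᵇ 1} (∨-trueʳ {A.accepts t′ a m}
           (fires⁺ t′ (stage t′ a k) m (haltsWithin-mono es t≤t′ halts) (<-≤-trans c<t t≤t′)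
                   (All-map (λ {x} → stage-mono-clock a k x t≤t′) marked′)))

  stage-diagonal-mono : ∀ a {t t′} m → t ≤ t′ → bit (stage t a t) m ≡ 1 → bit (stage t′ a t′) m ≡ 1
  stage-diagonal-mono a {t} {t′} m t≤t′ marked = stage-mono-rounds t′ a m t≤t′ (stage-mono-clock a t m t≤t′ marked)

  mutual
    stage-complete : ∀ {a m} → Derivable S (A a) m → ∃ λ t → bit (stage t a t) m ≡ 1
    stage-complete {a} {m} (base am) =
      t , stage-mono-rounds t a m (≤-trans (s≤s z≤n) m<t)
            (stage-suc⁺ t a 0 m m<t (∨-trueʳ {bit 0 m ≡ᵇ 1} (∨-trueˡ (A.monotone (m≤m⊔n t₀ (suc m)) accepted))))
      where
      t₀ = proj₁ (A.complete am)
      accepted = proj₂ (A.complete am)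
      t = t₀ ⊔ suc m
      m<t = m≤n⊔m t₀ (suc m)
    stage-complete {a} {m} (rule {ms = ms} s ds) =
      suc T , stage-mono-clock a (suc T) m (n≤1+n T)
                (stage-suc⁺ T a T m (<-trans (x<code-∷ m ms) c<T)
                  (∨-trueʳ {bit (stage T a T) m ≡ᵇ 1} (∨-trueʳ {A.accepts T a m}
                    (fires⁺ T (stage T a T) m (haltsWithin-mono es tr≤T halts) c<T
                            (All-map (λ {x} → stage-diagonal-mono a x T₀≤T) marked)))))
      where
      T₀ = proj₁ (stages-complete ds)
      marked = proj₂ (stages-complete ds)
      tr = proj₁ (rule-complete s)
      halts = proj₂ (rule-complete s)
      c = code (m ∷ ms)
      T = T₀ ⊔ tr ⊔ suc c
      T₀≤T = ≤-trans (m≤m⊔n T₀ tr) (m≤m⊔n (T₀ ⊔ tr) (suc c))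
      tr≤T = ≤-trans (m≤n⊔m T₀ tr) (m≤m⊔n (T₀ ⊔ tr) (suc c))
      c<T  = m≤n⊔m (T₀ ⊔ tr) (suc c)

    stages-complete : ∀ {a ms} → All (Derivable S (A a)) ms → ∃ λ T → All (λ x → bit (stage T a T) x ≡ 1) ms
    stages-complete []       = 0 , []
    stages-complete {a} {m ∷ _} (d ∷ ds) =
      let (t₁ , marked) = stage-complete d ; (t₂ , marked′) = stages-complete ds
      in t₁ ⊔ t₂ , stage-diagonal-mono a m (m≤m⊔n t₁ t₂) marked
                 ∷ All-map (λ {x} → stage-diagonal-mono a x (m≤n⊔m t₁ t₂)) marked′

  accepts-mono : ∀ {t t′ a m} → t ≤ t′ → accepts t a m ≡ true → accepts t′ a m ≡ true
  accepts-mono {t} {t′} {a} {m} t≤t′ h with ∧-true⁻ {m <ᵇ t} h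
  ... | m<t , marked =
    ∧-true⁺ (<ᵇ-true⁺ (<-≤-trans (<ᵇ-true⁻ m<t) t≤t′)) (≡ᵇ-true⁺ (stage-diagonal-mono a m t≤t′ (≡ᵇ-true⁻ marked)))

  accepts-sound : ∀ {t a m} → accepts t a m ≡ true → Derivable S (A a) m
  accepts-sound {t} {a} {m} h = stage-sound t a t m (≡ᵇ-true⁻ (proj₂ (∧-true⁻ {m <ᵇ t} h)))

  accepts-complete : ∀ {a m} → Derivable S (A a) m → ∃ λ t → accepts t a m ≡ true
  accepts-complete {a} {m} d =
    let (t , marked) = stage-complete d in t , ∧-true⁺ (<ᵇ-true⁺ (stage-< t a t m marked)) (≡ᵇ-true⁺ marked)

SemiDecider-Derivable : ∀ {S} → REList S → ∀ {A} → SemiDecider A → SemiDecider (λ a → Derivable S (A a))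
SemiDecider-Derivable S-re DA = record
  { accepts    = accepts
  ; computable = cAccepts
  ; monotone   = λ {t} {t′} {a} {m} → accepts-mono {t} {t′} {a} {m}
  ; sound      = λ {t} {a} {m} → accepts-sound {t} {a} {m}
  ; complete   = accepts-complete
  }
  where open DerivationSearch S-re DA

module _ (V : Quasivariety) where
  open Quasivariety V

  Derivable-point : ∀ A → Point V (Derivable S A)
  Derivable-point A m ms s derivable = rule s derivable

  Derivable-least : ∀ {A W} → Point V W → A ⊆ W → Derivable S A ⊆ W
  Derivable-least {A} {W} W-point A⊆W = derived
    where
    mutual
      derived : Derivable S A ⊆ W
      derived m (base a)              = A⊆W m a
      derived m (rule {ms = ms} s ds) = W-point m ms s (all-derived ds)
      all-derived : ∀ {ms} → All (Derivable S A) ms → All W ms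
      all-derived []       = []
      all-derived (d ∷ ds) = derived _ d ∷ all-derived ds

  presented⇔Derivable : ∀ {X Y} → IsPresentation V X Y → ∀ n → X n ⇔ Derivable S Y n
  presented⇔Derivable {Y = Y} (X-point , Y⊆X , least) n =
    mk⇔ (least (Derivable S Y) (Derivable-point Y) (λ _ → base) n) (Derivable-least X-point Y⊆X n)

  discriminated⇔ : ∀ {X Y Z} → IsPresentation V X Y → IsDiscriminator V X Z →
                   ∀ n → (¬ X n) ⇔ (∃ λ z → Derivable S (λ m → Y m ⊎ m ≡ n) z × Z z)
  discriminated⇔ {X} {Y} {Z} (X-point , Y⊆X , least) (disjoint , meets) n = mk⇔ outside inside
    where
    outside : ¬ X n → ∃ λ z → Derivable S (λ m → Y m ⊎ m ≡ n) z × Z z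
    outside ¬x = meets _ (Derivable-point _) (X⊆ , n , base (inj₂ refl) , ¬x)
      where
      X⊆ : X ⊆ Derivable S (λ m → Y m ⊎ m ≡ n)
      X⊆ = least _ (Derivable-point _) (λ m y → base (inj₁ y))
    inside : (∃ λ z → Derivable S (λ m → Y m ⊎ m ≡ n) z × Z z) → ¬ X n
    inside (z , derivable , z∈Z) x = disjoint z z∈Z (Derivable-least X-point Y∪n⊆X z derivable)
      where
      Y∪n⊆X : (λ m → Y m ⊎ m ≡ n) ⊆ X
      Y∪n⊆X m (inj₁ y)    = Y⊆X m y
      Y∪n⊆X m (inj₂ refl) = x

presented×discriminable⇒computable : ExcludedMiddle 0ℓ → ∀ V {X} →
  RecursivelyPresented V X → RecursivelyDiscriminable V X → Computable X
presented×discriminable⇒computable em V (Y , Y-re , presentation) (Z , Z-re , discriminator) =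
  SemiDeciders⇒Computable em
    (SemiDecider-resp (λ {_} {n} → Equivalence.from (presented⇔Derivable V presentation n))
                      (λ {_} {n} → Equivalence.to (presented⇔Derivable V presentation n))
                      (SemiDecider-Derivable S-re (RE⇒SemiDecider Y-re)))
    (SemiDecider-resp (λ {_} {n} → Equivalence.from (discriminated⇔ V presentation discriminator n))
                      (λ {_} {n} → Equivalence.to (discriminated⇔ V presentation discriminator n))
                      (SemiDecider-meets (SemiDecider-Derivable S-re (SemiDecider-adjoin (RE⇒SemiDecider Y-re)))
                                         (RE⇒SemiDecider Z-re)))
  where open Quasivariety V

RE-resp : ∀ {A B : Subset} → (∀ n → A n ⇔ B n) → RE A → RE B
RE-resp A⇔B (e , dom) = e , λ n →
  mk⇔ (Equivalence.to (dom n) ∘ Equivalence.from (A⇔B n)) (Equivalence.to (A⇔B n) ∘ Equivalence.from (dom n))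

zeros-RE : ∀ {f} → Comp₁ f → RE (λ n → f n ≡ 0)
zeros-RE {f} cf = Mf (proj₁ g) , λ n →
  mk⇔ (λ fn≡0 → 0 , evM (subst (proj₁ g [ 0 ∷ n ∷ [] ]⇓_) fn≡0 (proj₂ g (0 ∷ n ∷ []))) (λ _ ()))
      (λ { (y , evM g⇓0 _) → ⇓-deterministic (proj₂ g (y ∷ n ∷ [])) g⇓0 })
  where
  g : Comp 2 (λ xs → f (lookup xs (suc zero)))
  g = app₁ f cf arg₁

computable⇒RE : ExcludedMiddle 0ℓ → ∀ {X} → Computable X → RE X × RE (λ n → ¬ X n)
computable⇒RE em {X} (e , e-decides) =
  RE-resp member (zeros-RE (app₁ isZero cIsZero cχ)) , RE-resp nonmember (zeros-RE cχ)
  where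
  χ : ℕ → ℕ
  χ n = fromBool (does (em {X n}))
  χ⇓ : ∀ n → e [ n ∷ [] ]⇓ fromBool (does (em {X n}))
  χ⇓ n with em {X n}
  ... | yes x  = proj₁ (e-decides n) x
  ... | no  ¬x = proj₂ (e-decides n) ¬x
  cχ : Comp₁ χ
  cχ = e , λ { (n ∷ []) → χ⇓ n }
  member : ∀ n → (isZero (fromBool (does (em {X n}))) ≡ 0) ⇔ X n
  member n with em {X n}
  ... | yes x  = mk⇔ (λ _ → x) (λ _ → refl)
  ... | no  ¬x = mk⇔ (λ ()) (λ x → ⊥-elim (¬x x))
  nonmember : ∀ n → (fromBool (does (em {X n})) ≡ 0) ⇔ (¬ X n)
  nonmember n with em {X n}
  ... | yes x  = mk⇔ (λ ()) (λ ¬x → ⊥-elim (¬x x))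
  ... | no  ¬x = mk⇔ (λ _ → ¬x) (λ _ → refl)

computable⇒presented×discriminable : ExcludedMiddle 0ℓ → ∀ V {X} → Point V X → Computable X →
  RecursivelyPresented V X × RecursivelyDiscriminable V X
computable⇒presented×discriminable em V {X} X-point X-computable =
    (X , X-re , X-point , (λ _ x → x) , (λ _ _ X⊆X′ → X⊆X′))
  , ((λ n → ¬ X n) , ¬X-re , (λ _ ¬x → ¬x) , λ { _ _ (_ , n , x′ , ¬x) → n , x′ , ¬x })
  where
  X-re = proj₁ (computable⇒RE em X-computable)
  ¬X-re = proj₂ (computable⇒RE em X-computable)

mainTheorem10 : ExcludedMiddle 0ℓ → (V : Quasivariety) → (X : Subset) → Point V X →
    (Computable X → RecursivelyPresented V X × RecursivelyDiscriminable V X) ×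
    (RecursivelyPresented V X × RecursivelyDiscriminable V X → Computable X)
mainTheorem10 em V X X-point =
    computable⇒presented×discriminable em V X-point
  , λ (presented , discriminable) → presented×discriminable⇒computable em V presented discriminable
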